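{- For any $(2,3)$-agreeable graph $G=(V,E)$ on $n$ vertices, $|E| \geq \frac{n}{2}\bigl(n - \omega(G) - 1\bigr)$.
   Context: A simple undirected graph is $(2,3)$-agreeable if any three of its vertices induce a subgraph containing at least one edge. $\omega(G)$ denotes the clique number of $G$. -}

module Defs where

open import Data.Nat using (ℕ; zero; suc; _+_; _≤_)
open import Data.Bool using (Bool; true; false; if_then_else_)
open import Data.Fin using (Fin; _<?_)
open import Data.Fin.Subset using (Subset; _∈_; ∣_∣)
open import Data.List using (List; map; allFin)
open import Data.Nat.ListAction using (sum)
open import Data.Product using (_×_; Σ; ∃)
open import Data.Sum using (_⊎_)
open import Relation.Binary.PropositionalEquality using (_≡_; _≢_)
open import Relation.Nullary using (does)

record Graph (n : ℕ) : Set where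
  field
    adj   : Fin n → Fin n → Bool
    sym   : ∀ i j → adj i j ≡ adj j i
    irrefl : ∀ i → adj i i ≡ false
open Graph public

-- |E| : number of unordered pairs {i,j} (counted as i < j) that are adjacent
edgeCount : ∀ {n} → Graph n → ℕ
edgeCount {n} G =
  sum (map (λ i → sum (map (λ j →
    if does (i <? j) then (if adj G i j then 1 else 0) else 0) (allFin n))) (allFin n))

Agreeable23 : ∀ {n} → Graph n → Set
Agreeable23 {n} G = ∀ (i j k : Fin n) → i ≢ j → j ≢ k → i ≢ k →
  (adj G i j ≡ true) ⊎ (adj G j k ≡ true) ⊎ (adj G i k ≡ true)

IsClique : ∀ {n} → Graph n → Subset n → Set
IsClique G S = ∀ i j → i ∈ S → j ∈ S → i ≢ j → adj G i j ≡ true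

IsCliqueNumber : ∀ {n} → Graph n → ℕ → Set
IsCliqueNumber {n} G w =
  (Σ (Subset n) λ S → IsClique G S × ∣ S ∣ ≡ w) ×
  (∀ (S : Subset n) → IsClique G S → ∣ S ∣ ≤ w)

-- The vertices that are neither v nor adjacent to v form a clique: any two of
-- them, together with v, are three vertices that must induce an edge, and the
-- only possible one joins the two. Hence every degree is at least n - ω - 1, and
-- summing over the vertices (handshake lemma) gives 2|E| ≥ n (n - ω - 1).
module Submission where

open import Defs hiding (sym)
open import Data.Bool using (Bool; true; false; if_then_else_)
open import Data.Empty using (⊥-elim)
open import Data.Fin using (Fin; zero; suc; _<?_; _≟_)
open import Data.Fin.Properties using (<-cmp)
open import Data.Fin.Subset using (Subset; inside; outside; _∈_; _∉_; _⊆_; _∪_; _─_; _-_; ∁; ⁅_⁆; ∣_∣)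
open import Data.Fin.Subset.Properties
  using (x∈⁅x⁆; ∣⁅x⁆∣≡1; x∈p∪q⁺; x∈p∧x≢y⇒x∈p-y; p─q⊆p; p⊆q⇒∣p∣≤∣q∣; x∈∁p⇒x∉p; x∉⁅y⁆⇒x≢y; ∣∁p∣≡n∸∣p∣; ∣p∣≤n)
open import Data.List using (map; allFin)
import Data.List.Properties as List
import Data.Nat.ListAction as List
open import Data.Nat using (ℕ; zero; suc; _+_; _*_; _∸_; _≤_; z≤n; s≤s)
open import Data.Nat.Properties
  using (+-0-commutativeMonoid; ≤-trans; ≤-reflexive; +-mono-≤; +-monoʳ-≤; n≤1+n; +-suc; +-comm;
         +-identityʳ; m+[n∸m]≡n; m≤n+o⇒m∸n≤o; module ≤-Reasoning)
open import Data.Product using (_,_)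
open import Data.Sum using (inj₁; inj₂)
open import Data.Vec using ([]; _∷_; here; there; tabulate)
open import Data.Vec.Properties using (lookup∘tabulate; lookup⇒[]=)
open import Function using (_∘_)
open import Relation.Binary.Definitions using (tri<; tri≈; tri>)
open import Relation.Binary.PropositionalEquality
open import Relation.Nullary using (does; yes; no)
open import Relation.Nullary.Decidable using (dec-true; dec-false)

open import Algebra.Properties.CommutativeMonoid.Sum +-0-commutativeMonoid
  using (sum; sum-syntax; sum-cong-≗; ∑-distrib-+; ∑-comm)

indicator : Bool → ℕ
indicator b = if b then 1 else 0

sum-allFin : ∀ {n} (f : Fin n → ℕ) → List.sum (map f (allFin n)) ≡ sum f
sum-allFin {n} f = trans (cong List.sum (List.map-tabulate (λ i → i) f)) (sum-tabulate n f)
  where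
  sum-tabulate : ∀ n (f : Fin n → ℕ) → List.sum (Data.List.tabulate f) ≡ sum f
  sum-tabulate zero    f = refl
  sum-tabulate (suc n) f = cong (f zero +_) (sum-tabulate n (f ∘ suc))

∑-const : ∀ n c → ∑[ i < n ] c ≡ n * c
∑-const zero    c = refl
∑-const (suc n) c = cong (c +_) (∑-const n c)

∑-mono-≤ : ∀ {n} {f g : Fin n → ℕ} → (∀ i → f i ≤ g i) → sum f ≤ sum g
∑-mono-≤ {zero}  f≤g = z≤n
∑-mono-≤ {suc n} f≤g = +-mono-≤ (f≤g zero) (∑-mono-≤ (f≤g ∘ suc))

∣tabulate∣ : ∀ {n} (f : Fin n → Bool) → ∣ tabulate f ∣ ≡ ∑[ i < n ] indicator (f i)
∣tabulate∣ {zero}  f = refl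
∣tabulate∣ {suc n} f with f zero
... | true  = cong suc (∣tabulate∣ (f ∘ suc))
... | false = ∣tabulate∣ (f ∘ suc)

∈tabulate⁺ : ∀ {n} {f : Fin n → Bool} {i} → f i ≡ true → i ∈ tabulate f
∈tabulate⁺ {f = f} {i} fi = lookup⇒[]= i (tabulate f) (trans (lookup∘tabulate f i) fi)

∣p∪q∣≤∣p∣+∣q∣ : ∀ {n} (p q : Subset n) → ∣ p ∪ q ∣ ≤ ∣ p ∣ + ∣ q ∣
∣p∪q∣≤∣p∣+∣q∣ []            []            = z≤n
∣p∪q∣≤∣p∣+∣q∣ (outside ∷ p) (outside ∷ q) = ∣p∪q∣≤∣p∣+∣q∣ p q
∣p∪q∣≤∣p∣+∣q∣ (inside  ∷ p) (outside ∷ q) = s≤s (∣p∪q∣≤∣p∣+∣q∣ p q)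
∣p∪q∣≤∣p∣+∣q∣ (outside ∷ p) (inside  ∷ q) =
  ≤-trans (s≤s (∣p∪q∣≤∣p∣+∣q∣ p q)) (≤-reflexive (sym (+-suc ∣ p ∣ ∣ q ∣)))
∣p∪q∣≤∣p∣+∣q∣ (inside  ∷ p) (inside  ∷ q) =
  s≤s (≤-trans (∣p∪q∣≤∣p∣+∣q∣ p q) (+-monoʳ-≤ ∣ p ∣ (n≤1+n ∣ q ∣)))

x∈p─q⇒x∉q : ∀ {n} {x : Fin n} (p q : Subset n) → x ∈ p ─ q → x ∉ q
x∈p─q⇒x∉q (_ ∷ p) (outside ∷ q) here        ()
x∈p─q⇒x∉q (_ ∷ p) (_       ∷ q) (there x∈) (there x∈q) = x∈p─q⇒x∉q p q x∈ x∈q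

x∈p-y⇒x≢y : ∀ {n} {x y : Fin n} (p : Subset n) → x ∈ p - y → x ≢ y
x∈p-y⇒x≢y {y = y} p x∈ = x∉⁅y⁆⇒x≢y (x∈p─q⇒x∉q p ⁅ y ⁆ x∈)

∣p∣≤1+∣p-x∣ : ∀ {n} (p : Subset n) (x : Fin n) → ∣ p ∣ ≤ suc ∣ p - x ∣
∣p∣≤1+∣p-x∣ p x = begin
  ∣ p ∣                   ≤⟨ p⊆q⇒∣p∣≤∣q∣ p⊆⁅x⁆∪p-x ⟩
  ∣ ⁅ x ⁆ ∪ (p - x) ∣     ≤⟨ ∣p∪q∣≤∣p∣+∣q∣ ⁅ x ⁆ (p - x) ⟩
  ∣ ⁅ x ⁆ ∣ + ∣ p - x ∣   ≡⟨ cong (_+ ∣ p - x ∣) (∣⁅x⁆∣≡1 x) ⟩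
  suc ∣ p - x ∣           ∎
  where
  open ≤-Reasoning
  p⊆⁅x⁆∪p-x : p ⊆ ⁅ x ⁆ ∪ (p - x)
  p⊆⁅x⁆∪p-x {y} y∈p with y ≟ x
  ... | yes refl = x∈p∪q⁺ (inj₁ (x∈⁅x⁆ x))
  ... | no  y≢x  = x∈p∪q⁺ (inj₂ (x∈p∧x≢y⇒x∈p-y y∈p y≢x))

∣p∣+∣∁p∣≡n : ∀ {n} (p : Subset n) → ∣ p ∣ + ∣ ∁ p ∣ ≡ n
∣p∣+∣∁p∣≡n p = trans (cong (∣ p ∣ +_) (∣∁p∣≡n∸∣p∣ p)) (m+[n∸m]≡n (∣p∣≤n p))

module _ {n : ℕ} (G : Graph n) where

  neighbours : Fin n → Subset n
  neighbours i = tabulate (adj G i)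

  degree : Fin n → ℕ
  degree i = ∣ neighbours i ∣

  forwardEdge : Fin n → Fin n → ℕ
  forwardEdge i j = if does (i <? j) then indicator (adj G i j) else 0

  edgeCount≡∑forwardEdge : edgeCount G ≡ ∑[ i < n ] ∑[ j < n ] forwardEdge i j
  edgeCount≡∑forwardEdge =
    trans (cong List.sum (List.map-cong (sum-allFin ∘ forwardEdge) (allFin n)))
          (sum-allFin (λ i → ∑[ j < n ] forwardEdge i j))

  indicator-adj : ∀ i j → indicator (adj G i j) ≡ forwardEdge i j + forwardEdge j i
  indicator-adj i j with <-cmp i j
  ... | tri< i<j _ j≮i rewrite dec-true (i <? j) i<j | dec-false (j <? i) j≮i =
    sym (+-identityʳ _)
  ... | tri> i≮j _ j<i rewrite dec-false (i <? j) i≮j | dec-true (j <? i) j<i =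
    cong indicator (Graph.sym G i j)
  ... | tri≈ i≮i refl _ rewrite dec-false (i <? i) i≮i | irrefl G i = refl

  handshake : ∑[ i < n ] degree i ≡ 2 * edgeCount G
  handshake = begin
    ∑[ i < n ] degree i
      ≡⟨ sum-cong-≗ (λ i → ∣tabulate∣ (adj G i)) ⟩
    ∑[ i < n ] ∑[ j < n ] indicator (adj G i j)
      ≡⟨ sum-cong-≗ (λ i → sum-cong-≗ (indicator-adj i)) ⟩
    ∑[ i < n ] ∑[ j < n ] (forwardEdge i j + forwardEdge j i)
      ≡⟨ sum-cong-≗ (λ i → ∑-distrib-+ (forwardEdge i) (λ j → forwardEdge j i)) ⟩
    ∑[ i < n ] (∑[ j < n ] forwardEdge i j + ∑[ j < n ] forwardEdge j i)
      ≡⟨ ∑-distrib-+ (λ i → ∑[ j < n ] forwardEdge i j) (λ i → ∑[ j < n ] forwardEdge j i) ⟩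
    E + ∑[ i < n ] ∑[ j < n ] forwardEdge j i
      ≡⟨ cong (E +_) (∑-comm forwardEdge) ⟨
    E + E
      ≡⟨ cong (E +_) (+-identityʳ E) ⟨
    2 * E
      ≡⟨ cong (2 *_) edgeCount≡∑forwardEdge ⟨
    2 * edgeCount G ∎
    where
    open ≡-Reasoning
    E : ℕ
    E = ∑[ i < n ] ∑[ j < n ] forwardEdge i j

  nonNeighbours : Fin n → Subset n
  nonNeighbours i = ∁ (neighbours i) - i

  n≤1+degree+∣nonNeighbours∣ : ∀ i → n ≤ suc (degree i + ∣ nonNeighbours i ∣)
  n≤1+degree+∣nonNeighbours∣ i = begin
    n                                   ≡⟨ ∣p∣+∣∁p∣≡n (neighbours i) ⟨
    degree i + ∣ ∁ (neighbours i) ∣     ≤⟨ +-monoʳ-≤ (degree i) (∣p∣≤1+∣p-x∣ (∁ (neighbours i)) i) ⟩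
    degree i + suc ∣ nonNeighbours i ∣  ≡⟨ +-suc (degree i) _ ⟩
    suc (degree i + ∣ nonNeighbours i ∣) ∎
    where open ≤-Reasoning

  nonNeighbours-nonAdjacent : ∀ {i x} → x ∈ nonNeighbours i → adj G i x ≢ true
  nonNeighbours-nonAdjacent {i} x∈C ix =
    x∈∁p⇒x∉p (p─q⊆p (∁ (neighbours i)) ⁅ i ⁆ x∈C) (∈tabulate⁺ ix)

  nonNeighbours-distinct : ∀ {i x} → x ∈ nonNeighbours i → i ≢ x
  nonNeighbours-distinct {i} x∈C = x∈p-y⇒x≢y (∁ (neighbours i)) x∈C ∘ sym

  nonNeighbours-isClique : Agreeable23 G → ∀ i → IsClique G (nonNeighbours i)
  nonNeighbours-isClique agree i x y x∈C y∈C x≢y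
    with agree i x y (nonNeighbours-distinct x∈C) x≢y (nonNeighbours-distinct y∈C)
  ... | inj₁ ix        = ⊥-elim (nonNeighbours-nonAdjacent x∈C ix)
  ... | inj₂ (inj₁ xy) = xy
  ... | inj₂ (inj₂ iy) = ⊥-elim (nonNeighbours-nonAdjacent y∈C iy)

m≤1+n+o⇒m∸o∸1≤n : ∀ {m} n o → m ≤ suc (n + o) → m ∸ o ∸ 1 ≤ n
m≤1+n+o⇒m∸o∸1≤n {m} n o m≤1+n+o =
  m≤n+o⇒m∸n≤o (m ∸ o) 1 (m≤n+o⇒m∸n≤o m o (≤-trans m≤1+n+o (≤-reflexive 1+n+o≡o+1+n)))
  where
  1+n+o≡o+1+n : suc (n + o) ≡ o + suc n
  1+n+o≡o+1+n = trans (cong suc (+-comm n o)) (sym (+-suc o n))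

corollary4p2 : ∀ (n : ℕ) (G : Graph n) (w : ℕ) → Agreeable23 G → IsCliqueNumber G w →
    n * (n ∸ w ∸ 1) ≤ 2 * edgeCount G
corollary4p2 n G w agree (_ , maximum) = begin
  n * (n ∸ w ∸ 1)          ≡⟨ ∑-const n (n ∸ w ∸ 1) ⟨
  ∑[ i < n ] (n ∸ w ∸ 1)   ≤⟨ ∑-mono-≤ degree-lowerBound ⟩
  ∑[ i < n ] degree G i    ≡⟨ handshake G ⟩
  2 * edgeCount G          ∎
  where
  open ≤-Reasoning
  degree-lowerBound : ∀ i → n ∸ w ∸ 1 ≤ degree G i
  degree-lowerBound i = m≤1+n+o⇒m∸o∸1≤n (degree G i) w (begin
    n                                          ≤⟨ n≤1+degree+∣nonNeighbours∣ G i ⟩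
    suc (degree G i + ∣ nonNeighbours G i ∣)   ≤⟨ s≤s (+-monoʳ-≤ (degree G i) ∣C∣≤w) ⟩
    suc (degree G i + w)                       ∎)
    where
    ∣C∣≤w : ∣ nonNeighbours G i ∣ ≤ w
    ∣C∣≤w = maximum (nonNeighbours G i) (nonNeighbours-isClique G agree i)
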